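{- Let $\mathcal D$ be a non-increasing degree sequence of a simple graph with $m\ge1$ edges. Every source of $G(\mathcal D)$ is a (non-strict) local minimum, and every sink of $G(\mathcal D)$ is a (non-strict) local maximum, of $M_2$ and of $Z_2$, where "local" refers to adjacency in $G(\mathcal D)$.
   Context: $\mathcal M(\mathcal D)$ is the set of symmetric $n\times n$ $(0,1)$-matrices with zero diagonal and row sums $\mathcal D$. For pairwise distinct $i,j,k,l$ with $i<j$, $k<l$, $\mathcal C_{ijkl}$ has entries $+1$ at $(i,k),(k,i),(j,l),(l,j)$, $-1$ at $(i,l),(l,i),(j,k),(k,j)$, $0$ elsewhere; a positive switch replaces $\mathbf A$ by $\mathbf A+\mathcal C_{ijkl}\in\mathcal M(\mathcal D)$. $G(\mathcal D)$ is the directed graph on $\mathcal M(\mathcal D)$ with an arc $\mathbf A\to\mathbf A'$ when $\mathbf A'$ is obtained from $\mathbf A$ by one positive switch; sources have no incoming arcs, sinks no outgoing arcs. For $\mathbf A$ with edge set $E$, $M_2(\mathbf A)=\sum_{\{u,v\}\in E}d_ud_v$ and $Z_2(\mathbf A)=\sqrt{M_2(\mathbf A)/m}$. -}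

module Defs where

open import Data.Nat as ℕ using (ℕ; zero; suc)
open import Data.Integer as ℤ using (ℤ; +_; -_)
open import Data.Fin using (Fin; zero; suc; _<_; _≤_; _≟_)
import Data.Rational as ℚ
open import Data.Product using (Σ; ∃; _×_; _,_)
open import Data.Sum using (_⊎_)
open import Relation.Nullary using (¬_; yes; no)
open import Relation.Binary.PropositionalEquality using (_≡_; _≢_)
open import Data.Fin using (_<?_)
open import Relation.Nullary.Decidable using (does)
open import Data.Bool using (if_then_else_)

∑ : {n : ℕ} → (Fin n → ℤ) → ℤ
∑ {zero}  f = + 0
∑ {suc n} f = f zero ℤ.+ ∑ (λ i → f (suc i))

∑ℕ : {n : ℕ} → (Fin n → ℕ) → ℕ
∑ℕ {zero}  f = 0
∑ℕ {suc n} f = f zero ℕ.+ ∑ℕ (λ i → f (suc i))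

DegSeq : ℕ → Set
DegSeq n = Fin n → ℕ

Matrix : ℕ → Set
Matrix n = Fin n → Fin n → ℤ

NonIncreasing : {n : ℕ} → DegSeq n → Set
NonIncreasing {n} D = ∀ (i j : Fin n) → i ≤ j → D j ℕ.≤ D i

record InM {n : ℕ} (D : DegSeq n) (A : Matrix n) : Set where
  field
    zero-one  : ∀ i j → (A i j ≡ + 0) ⊎ (A i j ≡ + 1)
    symmetric : ∀ i j → A i j ≡ A j i
    diag      : ∀ i → A i i ≡ + 0
    rowsum    : ∀ i → ∑ (λ j → A i j) ≡ + D i

δ : {n : ℕ} → Fin n → Fin n → ℤ
δ a b = if does (a ≟ b) then + 1 else + 0

switchC : {n : ℕ} → Fin n → Fin n → Fin n → Fin n → Matrix n
switchC i j k l r c =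
  ((δ r i ℤ.* δ c k) ℤ.+ (δ r k ℤ.* δ c i) ℤ.+ (δ r j ℤ.* δ c l) ℤ.+ (δ r l ℤ.* δ c j))
  ℤ.- ((δ r i ℤ.* δ c l) ℤ.+ (δ r l ℤ.* δ c i) ℤ.+ (δ r j ℤ.* δ c k) ℤ.+ (δ r k ℤ.* δ c j))

PairwiseDistinct : {n : ℕ} → Fin n → Fin n → Fin n → Fin n → Set
PairwiseDistinct i j k l =
  i ≢ j × i ≢ k × i ≢ l × j ≢ k × j ≢ l × k ≢ l

Arc : {n : ℕ} → DegSeq n → Matrix n → Matrix n → Set
Arc {n} D A A' =
  InM D A × InM D A' ×
  Σ (Fin n) λ i → Σ (Fin n) λ j → Σ (Fin n) λ k → Σ (Fin n) λ l →
    PairwiseDistinct i j k l × i < j × k < l ×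
    (∀ r c → A' r c ≡ A r c ℤ.+ switchC i j k l r c)

Adjacent : {n : ℕ} → DegSeq n → Matrix n → Matrix n → Set
Adjacent D A A' = Arc D A A' ⊎ Arc D A' A

IsSource : {n : ℕ} → DegSeq n → Matrix n → Set
IsSource {n} D A = InM D A × ¬ (Σ (Matrix n) λ B → Arc D B A)

IsSink : {n : ℕ} → DegSeq n → Matrix n → Set
IsSink {n} D A = InM D A × ¬ (Σ (Matrix n) λ B → Arc D A B)

-- indicator of u < v (each unordered edge {u,v} counted once)
[_<_] : {n : ℕ} → Fin n → Fin n → ℤ
[ u < v ] = if does (u <? v) then + 1 else + 0

M2 : {n : ℕ} → DegSeq n → Matrix n → ℤ
M2 D A = ∑ λ u → ∑ λ v → [ u < v ] ℤ.* A u v ℤ.* (+ D u) ℤ.* (+ D v)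

edges : {n : ℕ} → Matrix n → ℕ
edges A = ℤ.∣ ∑ (λ u → ∑ λ v → [ u < v ] ℤ.* A u v) ∣

-- Z₂(A)² = M₂(A)/m  (Z₂ itself involves a square root)
Z2sq : {n : ℕ} → DegSeq n → Matrix n → ℚ.ℚ
Z2sq D A with edges A
... | zero  = ℚ.0ℚ
... | suc k = M2 D A ℚ./ suc k

LocalMinℤ : {n : ℕ} → DegSeq n → (Matrix n → ℤ) → Matrix n → Set
LocalMinℤ {n} D f A = ∀ (A' : Matrix n) → Adjacent D A A' → f A ℤ.≤ f A'

LocalMaxℤ : {n : ℕ} → DegSeq n → (Matrix n → ℤ) → Matrix n → Set
LocalMaxℤ {n} D f A = ∀ (A' : Matrix n) → Adjacent D A A' → f A' ℤ.≤ f A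

LocalMinℚ : {n : ℕ} → DegSeq n → (Matrix n → ℚ.ℚ) → Matrix n → Set
LocalMinℚ {n} D f A = ∀ (A' : Matrix n) → Adjacent D A A' → f A ℚ.≤ f A'

LocalMaxℚ : {n : ℕ} → DegSeq n → (Matrix n → ℚ.ℚ) → Matrix n → Set
LocalMaxℚ {n} D f A = ∀ (A' : Matrix n) → Adjacent D A A' → f A' ℚ.≤ f A

{-# OPTIONS --safe #-}
-- Both M₂ and the edge count are sums ⟪ w , A ⟫ = ∑ w u v A u v with w supported on
-- u < v.  The switch 𝓒ᵢⱼₖₗ is a signed sum of four symmetric pairs of unit matrices,
-- so it changes such a sum by (w + wᵀ) evaluated on those pairs: by
-- dᵢdₖ + dⱼdₗ − dᵢdₗ − dⱼdₖ = (dᵢ − dⱼ)(dₖ − dₗ) ≥ 0 for M₂ (as i < j, k < l and D is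
-- non-increasing), and by 0 for the edge count.  Hence M₂ and Z₂ weakly increase
-- along every arc of G(D); all neighbours of a source are reached by arcs leaving
-- it, and all neighbours of a sink by arcs entering it.
module Submission where

open import Defs
open import Data.Nat using (ℕ; _≤_; zero; suc)
open import Data.Product using (_×_; Σ; _,_)

import Data.Nat.Properties as ℕ
open import Data.Integer as ℤ using (ℤ; +_; -_; _+_; _-_; _*_; 0ℤ; +≤+)
import Data.Integer.Properties as ℤ
open import Data.Integer.Tactic.RingSolver using (solve-∀)
open import Algebra.Properties.CommutativeSemigroup ℤ.+-commutativeSemigroup
  using (interchange)
open import Data.Fin as Fin using (Fin; zero; suc)
import Data.Fin.Properties as Fin
import Data.Rational as ℚ
import Data.Rational.Properties as ℚ
import Data.Rational.Unnormalised as ℚᵘ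
import Data.Rational.Unnormalised.Properties as ℚᵘ
open import Data.Sum using (inj₁; inj₂)
open import Data.Bool using (if_then_else_)
open import Data.Empty using (⊥-elim)
open import Level using (Level)
open import Relation.Binary.Core using (Rel)
open import Relation.Binary.Definitions using (tri<; tri≈; tri>)
open import Relation.Binary.PropositionalEquality
open import Relation.Nullary using (¬_)
open import Relation.Nullary.Decidable using (dec-true; dec-false)

private
  variable
    n : ℕ

∑-cong : {f g : Fin n → ℤ} → (∀ i → f i ≡ g i) → ∑ f ≡ ∑ g
∑-cong {zero}  f≗g = refl
∑-cong {suc n} f≗g = cong₂ _+_ (f≗g zero) (∑-cong (λ i → f≗g (suc i)))

∑-distrib-+ : (f g : Fin n → ℤ) → ∑ (λ i → f i + g i) ≡ ∑ f + ∑ g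
∑-distrib-+ {zero}  f g = refl
∑-distrib-+ {suc n} f g = trans
  (cong (_+_ (f zero + g zero)) (∑-distrib-+ (λ i → f (suc i)) (λ i → g (suc i))))
  (interchange (f zero) (g zero) _ _)

∑-distrib-neg : (f : Fin n → ℤ) → ∑ (λ i → - f i) ≡ - ∑ f
∑-distrib-neg {zero}  f = refl
∑-distrib-neg {suc n} f = trans
  (cong (_+_ (- f zero)) (∑-distrib-neg (λ i → f (suc i))))
  (sym (ℤ.neg-distrib-+ (f zero) _))

∑-distrib-minus : (f g : Fin n → ℤ) → ∑ (λ i → f i - g i) ≡ ∑ f - ∑ g
∑-distrib-minus f g =
  trans (∑-distrib-+ f (λ i → - g i)) (cong (_+_ (∑ f)) (∑-distrib-neg g))

∑-*ʳ : (c : ℤ) (f : Fin n → ℤ) → ∑ (λ i → f i * c) ≡ ∑ f * c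
∑-*ʳ {zero}  c f = sym (ℤ.*-zeroˡ c)
∑-*ʳ {suc n} c f = trans
  (cong (_+_ (f zero * c)) (∑-*ʳ c (λ i → f (suc i))))
  (sym (ℤ.*-distribʳ-+ c (f zero) _))

∑-select : (f : Fin n → ℤ) (a : Fin n) → ∑ (λ i → f i * δ i a) ≡ f a
∑-select {suc n} f zero = begin
  f zero * + 1 + ∑ (λ i → f (suc i) * + 0) ≡⟨ cong₂ _+_ (ℤ.*-identityʳ (f zero)) zeros ⟩
  f zero + + 0                              ≡⟨ ℤ.+-identityʳ (f zero) ⟩
  f zero                                    ∎
  where
  open ≡-Reasoning
  zeros : ∑ (λ i → f (suc i) * + 0) ≡ + 0
  zeros = trans (∑-*ʳ (+ 0) (λ i → f (suc i))) (ℤ.*-zeroʳ (∑ λ i → f (suc i)))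
∑-select {suc n} f (suc a) =
  trans (cong₂ _+_ (ℤ.*-zeroʳ (f zero)) (∑-select (λ i → f (suc i)) a))
        (ℤ.+-identityˡ (f (suc a)))

Weight : ℕ → Set
Weight n = Fin n → Fin n → ℤ

⟪_,_⟫ : Weight n → Matrix n → ℤ
⟪ w , A ⟫ = ∑ λ u → ∑ λ v → w u v * A u v

_⊞_ _⊟_ : Matrix n → Matrix n → Matrix n
(A ⊞ B) u v = A u v + B u v
(A ⊟ B) u v = A u v - B u v

unit : Fin n → Fin n → Matrix n
unit a b u v = δ u a * δ v b

⟪⟫-congʳ : (w : Weight n) {A B : Matrix n} →
           (∀ u v → A u v ≡ B u v) → ⟪ w , A ⟫ ≡ ⟪ w , B ⟫
⟪⟫-congʳ w A≗B = ∑-cong (λ u → ∑-cong (λ v → cong (w u v *_) (A≗B u v)))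

⟪⟫-⊞ : (w : Weight n) (A B : Matrix n) → ⟪ w , A ⊞ B ⟫ ≡ ⟪ w , A ⟫ + ⟪ w , B ⟫
⟪⟫-⊞ w A B = trans
  (∑-cong (λ u → trans (∑-cong (λ v → ℤ.*-distribˡ-+ (w u v) (A u v) (B u v)))
                       (∑-distrib-+ (λ v → w u v * A u v) (λ v → w u v * B u v))))
  (∑-distrib-+ (λ u → ∑ λ v → w u v * A u v) (λ u → ∑ λ v → w u v * B u v))

⟪⟫-⊟ : (w : Weight n) (A B : Matrix n) → ⟪ w , A ⊟ B ⟫ ≡ ⟪ w , A ⟫ - ⟪ w , B ⟫
⟪⟫-⊟ w A B = trans
  (∑-cong (λ u → trans (∑-cong (λ v → *-distribˡ-minus (w u v) (A u v) (B u v)))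
                       (∑-distrib-minus (λ v → w u v * A u v) (λ v → w u v * B u v))))
  (∑-distrib-minus (λ u → ∑ λ v → w u v * A u v) (λ u → ∑ λ v → w u v * B u v))
  where
  *-distribˡ-minus : ∀ x y z → x * (y - z) ≡ x * y - x * z
  *-distribˡ-minus = solve-∀

⟪⟫-unit : (w : Weight n) (a b : Fin n) → ⟪ w , unit a b ⟫ ≡ w a b
⟪⟫-unit w a b = begin
  ∑ (λ u → ∑ λ v → w u v * (δ u a * δ v b))
    ≡⟨ ∑-cong (λ u → ∑-cong (λ v → reorder (w u v) (δ u a) (δ v b))) ⟩
  ∑ (λ u → ∑ λ v → w u v * δ v b * δ u a)
    ≡⟨ ∑-cong (λ u → ∑-*ʳ (δ u a) (λ v → w u v * δ v b)) ⟩
  ∑ (λ u → ∑ (λ v → w u v * δ v b) * δ u a)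
    ≡⟨ ∑-cong (λ u → cong (_* δ u a) (∑-select (w u) b)) ⟩
  ∑ (λ u → w u b * δ u a)
    ≡⟨ ∑-select (λ u → w u b) a ⟩
  w a b ∎
  where
  open ≡-Reasoning
  reorder : ∀ x y z → x * (y * z) ≡ x * z * y
  reorder = solve-∀

module _ (w g : Weight n) (w+wᵀ≡g : ∀ {a b} → a ≢ b → w a b + w b a ≡ g a b) where

  ⟪⟫-symmetricPair : ∀ {a b c d} → a ≢ b → c ≢ d →
    ⟪ w , ((unit a b ⊞ unit b a) ⊞ unit c d) ⊞ unit d c ⟫ ≡ g a b + g c d
  ⟪⟫-symmetricPair {a} {b} {c} {d} a≢b c≢d = begin
    ⟪ w , ((unit a b ⊞ unit b a) ⊞ unit c d) ⊞ unit d c ⟫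
      ≡⟨ ⟪⟫-⊞ w _ (unit d c) ⟩
    ⟪ w , (unit a b ⊞ unit b a) ⊞ unit c d ⟫ + ⟪ w , unit d c ⟫
      ≡⟨ cong₂ _+_ (⟪⟫-⊞ w _ (unit c d)) (⟪⟫-unit w d c) ⟩
    ⟪ w , unit a b ⊞ unit b a ⟫ + ⟪ w , unit c d ⟫ + w d c
      ≡⟨ cong (λ x → x + ⟪ w , unit c d ⟫ + w d c) (⟪⟫-⊞ w (unit a b) (unit b a)) ⟩
    ⟪ w , unit a b ⟫ + ⟪ w , unit b a ⟫ + ⟪ w , unit c d ⟫ + w d c
      ≡⟨ cong (λ x → x + w d c) (cong₂ _+_ (cong₂ _+_ (⟪⟫-unit w a b) (⟪⟫-unit w b a))
                                           (⟪⟫-unit w c d)) ⟩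
    w a b + w b a + w c d + w d c
      ≡⟨ ℤ.+-assoc (w a b + w b a) (w c d) (w d c) ⟩
    (w a b + w b a) + (w c d + w d c)
      ≡⟨ cong₂ _+_ (w+wᵀ≡g a≢b) (w+wᵀ≡g c≢d) ⟩
    g a b + g c d ∎
    where open ≡-Reasoning

  ⟪⟫-switchC : {i j k l : Fin n} → PairwiseDistinct i j k l →
    ⟪ w , switchC i j k l ⟫ ≡ (g i k + g j l) - (g i l + g j k)
  ⟪⟫-switchC {i} {j} {k} {l} (i≢j , i≢k , i≢l , j≢k , j≢l , k≢l) = trans
    -- switchC i j k l is definitionally this difference of unit matrices.
    (⟪⟫-⊟ w (((unit i k ⊞ unit k i) ⊞ unit j l) ⊞ unit l j)
            (((unit i l ⊞ unit l i) ⊞ unit j k) ⊞ unit k j))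
    (cong₂ _-_ (⟪⟫-symmetricPair i≢k j≢l) (⟪⟫-symmetricPair i≢l j≢k))

  ⟪⟫-switch : {i j k l : Fin n} {A A' : Matrix n} → PairwiseDistinct i j k l →
    (∀ r c → A' r c ≡ (A ⊞ switchC i j k l) r c) →
    ⟪ w , A' ⟫ ≡ ⟪ w , A ⟫ + ((g i k + g j l) - (g i l + g j k))
  ⟪⟫-switch {i} {j} {k} {l} {A} distinct A'≡A+C = trans (⟪⟫-congʳ w A'≡A+C)
    (trans (⟪⟫-⊞ w A (switchC i j k l)) (cong (_+_ ⟪ w , A ⟫) (⟪⟫-switchC distinct)))

[<]-yes : {a b : Fin n} → a Fin.< b → [ a < b ] ≡ + 1
[<]-yes {a = a} {b} a<b = cong (λ t → if t then + 1 else + 0) (dec-true (a Fin.<? b) a<b)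

[<]-no : {a b : Fin n} → ¬ a Fin.< b → [ a < b ] ≡ + 0
[<]-no {a = a} {b} a≮b = cong (λ t → if t then + 1 else + 0) (dec-false (a Fin.<? b) a≮b)

[<]-complement : {a b : Fin n} → a ≢ b → [ a < b ] + [ b < a ] ≡ + 1
[<]-complement {a = a} {b} a≢b with Fin.<-cmp a b
... | tri< a<b _ b≮a = cong₂ _+_ ([<]-yes a<b) ([<]-no b≮a)
... | tri≈ _ a≡b _   = ⊥-elim (a≢b a≡b)
... | tri> a≮b _ b<a = cong₂ _+_ ([<]-no a≮b) ([<]-yes b<a)

0≤i⇒0≤j⇒0≤i*j : {i j : ℤ} → 0ℤ ℤ.≤ i → 0ℤ ℤ.≤ j → 0ℤ ℤ.≤ i * j
0≤i⇒0≤j⇒0≤i*j {i} {j} 0≤i 0≤j =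
  subst (ℤ._≤ i * j) (ℤ.*-zeroʳ i) (ℤ.*-monoˡ-≤-nonNeg i {{ℤ.nonNegative 0≤i}} 0≤j)

strictUpper : Weight n → Weight n
strictUpper g u v = [ u < v ] * g u v

strictUpper+strictUpperᵀ : (g : Weight n) → (∀ a b → g a b ≡ g b a) →
  ∀ {a b} → a ≢ b → strictUpper g a b + strictUpper g b a ≡ g a b
strictUpper+strictUpperᵀ g g-sym {a} {b} a≢b = begin
  [ a < b ] * g a b + [ b < a ] * g b a
    ≡⟨ cong (λ x → [ a < b ] * g a b + [ b < a ] * x) (g-sym b a) ⟩
  [ a < b ] * g a b + [ b < a ] * g a b
    ≡⟨ ℤ.*-distribʳ-+ (g a b) [ a < b ] [ b < a ] ⟨
  ([ a < b ] + [ b < a ]) * g a b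
    ≡⟨ cong (_* g a b) ([<]-complement a≢b) ⟩
  + 1 * g a b
    ≡⟨ ℤ.*-identityˡ (g a b) ⟩
  g a b ∎
  where open ≡-Reasoning

fromℚᵘ-mono-≤ : {p q : ℚᵘ.ℚᵘ} → p ℚᵘ.≤ q → ℚ.fromℚᵘ p ℚ.≤ ℚ.fromℚᵘ q
fromℚᵘ-mono-≤ {p} {q} p≤q = ℚ.toℚᵘ-cancel-≤
  (ℚᵘ.≤-respˡ-≃ (ℚᵘ.≃-sym (ℚ.toℚᵘ-fromℚᵘ p))
  (ℚᵘ.≤-respʳ-≃ (ℚᵘ.≃-sym (ℚ.toℚᵘ-fromℚᵘ q)) p≤q))

/-monoˡ-≤ : {x y : ℤ} (m : ℕ) → x ℤ.≤ y → x ℚ./ suc m ℚ.≤ y ℚ./ suc m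
-- x ℚ./ suc m unfolds to ℚ.fromℚᵘ (ℚᵘ.mkℚᵘ x m).
/-monoˡ-≤ {x} {y} m x≤y = fromℚᵘ-mono-≤ {ℚᵘ.mkℚᵘ x m} {ℚᵘ.mkℚᵘ y m}
  (ℚᵘ.*≤* (ℤ.*-monoʳ-≤-nonNeg (+ suc m) x≤y))

Z2sq-mono : {D : DegSeq n} {A B : Matrix n} →
  M2 D A ℤ.≤ M2 D B → edges A ≡ edges B → Z2sq D A ℚ.≤ Z2sq D B
Z2sq-mono {A = A} {B} M2≤ same-edges with edges A | edges B | same-edges
... | zero  | .zero    | refl = ℚ.≤-refl
... | suc m | .(suc m) | refl = /-monoˡ-≤ m M2≤

module _ {n : ℕ} (D : DegSeq n) where

  degreeProduct : Weight n
  degreeProduct u v = + D u * + D v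

  M2≡⟪⟫ : (A : Matrix n) → M2 D A ≡ ⟪ strictUpper degreeProduct , A ⟫
  M2≡⟪⟫ A = ∑-cong (λ u → ∑-cong (λ v → reorder [ u < v ] (A u v) (+ D u) (+ D v)))
    where
    reorder : ∀ e a x y → e * a * x * y ≡ e * (x * y) * a
    reorder = solve-∀

  M2-switch : {i j k l : Fin n} {A A' : Matrix n} → PairwiseDistinct i j k l →
    (∀ r c → A' r c ≡ (A ⊞ switchC i j k l) r c) →
    M2 D A' ≡ M2 D A + (+ D i - + D j) * (+ D k - + D l)
  M2-switch {i} {j} {k} {l} {A} {A'} distinct A'≡A+C = begin
    M2 D A'
      ≡⟨ M2≡⟪⟫ A' ⟩
    ⟪ strictUpper degreeProduct , A' ⟫
      ≡⟨ ⟪⟫-switch (strictUpper degreeProduct) degreeProduct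
           (strictUpper+strictUpperᵀ degreeProduct (λ a b → ℤ.*-comm (+ D a) (+ D b)))
           distinct A'≡A+C ⟩
    ⟪ strictUpper degreeProduct , A ⟫ + (dᵢ * dₖ + dⱼ * dₗ - (dᵢ * dₗ + dⱼ * dₖ))
      ≡⟨ cong₂ _+_ (M2≡⟪⟫ A) (cross-difference dᵢ dⱼ dₖ dₗ) ⟨
    M2 D A + (dᵢ - dⱼ) * (dₖ - dₗ) ∎
    where
    open ≡-Reasoning
    dᵢ = + D i; dⱼ = + D j; dₖ = + D k; dₗ = + D l
    cross-difference : ∀ a b c d → (a - b) * (c - d) ≡ a * c + b * d - (a * d + b * c)
    cross-difference = solve-∀

  M2-mono-arc : NonIncreasing D → ∀ {A A'} → Arc D A A' → M2 D A ℤ.≤ M2 D A'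
  M2-mono-arc D-nonInc (_ , _ , i , j , k , l , distinct , i<j , k<l , A'≡A+C) =
    subst (M2 D _ ℤ.≤_) (sym (M2-switch distinct A'≡A+C))
      (ℤ.i≤i+j (M2 D _) _ {{ℤ.nonNegative gain}})
    where
    degree-drop : ∀ {a b} → a Fin.< b → 0ℤ ℤ.≤ + D a - + D b
    degree-drop {a} {b} a<b = ℤ.i≤j⇒0≤j-i (+≤+ (D-nonInc a b (ℕ.<⇒≤ a<b)))
    gain : 0ℤ ℤ.≤ (+ D i - + D j) * (+ D k - + D l)
    gain = 0≤i⇒0≤j⇒0≤i*j (degree-drop i<j) (degree-drop k<l)

  edges-switch : {i j k l : Fin n} {A A' : Matrix n} → PairwiseDistinct i j k l →
    (∀ r c → A' r c ≡ (A ⊞ switchC i j k l) r c) → edges A' ≡ edges A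
  edges-switch {A = A} distinct A'≡A+C = cong ℤ.∣_∣
    (trans (⟪⟫-switch [_<_] (λ _ _ → + 1) [<]-complement {A = A} distinct A'≡A+C)
           (ℤ.+-identityʳ ⟪ [_<_] , A ⟫))

  edges-arc : ∀ {A A'} → Arc D A A' → edges A' ≡ edges A
  edges-arc (_ , _ , _ , _ , _ , _ , distinct , _ , _ , A'≡A+C) = edges-switch distinct A'≡A+C

  Z2sq-mono-arc : NonIncreasing D → ∀ {A A'} → Arc D A A' → Z2sq D A ℚ.≤ Z2sq D A'
  Z2sq-mono-arc D-nonInc {A} {A'} arc =
    Z2sq-mono {D = D} {A} {A'} (M2-mono-arc D-nonInc arc) (sym (edges-arc arc))

module _ {a ℓ : Level} {D : DegSeq n} {X : Set a} (_≲_ : Rel X ℓ) (f : Matrix n → X)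
         (f-mono : ∀ {A A'} → Arc D A A' → f A ≲ f A') where

  source⇒minimum : {A : Matrix n} → IsSource D A → ∀ A' → Adjacent D A A' → f A ≲ f A'
  source⇒minimum _            A' (inj₁ A→A') = f-mono A→A'
  source⇒minimum (_ , no-arc) A' (inj₂ A'→A) = ⊥-elim (no-arc (A' , A'→A))

  sink⇒maximum : {A : Matrix n} → IsSink D A → ∀ A' → Adjacent D A A' → f A' ≲ f A
  sink⇒maximum (_ , no-arc) A' (inj₁ A→A') = ⊥-elim (no-arc (A' , A→A'))
  sink⇒maximum _            A' (inj₂ A'→A) = f-mono A'→A

-- The hypotheses 𝓜(D) ≠ ∅ and m ≥ 1 are not needed: switches preserve m, so
-- Z2sq compares M₂ over the same denominator even in the junk case m = 0.
corollary4 : (n : ℕ) (D : DegSeq n) →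
    NonIncreasing D →
    Σ (Matrix n) (InM D) →
    2 ≤ ∑ℕ D →
    ((A : Matrix n) → IsSource D A →
       LocalMinℤ D (M2 D) A × LocalMinℚ D (Z2sq D) A) ×
    ((A : Matrix n) → IsSink D A →
       LocalMaxℤ D (M2 D) A × LocalMaxℚ D (Z2sq D) A)
corollary4 n D D-nonInc _ _ =
  (λ A source → source⇒minimum ℤ._≤_ (M2 D) (M2-mono-arc D D-nonInc) source
              , source⇒minimum ℚ._≤_ (Z2sq D) (Z2sq-mono-arc D D-nonInc) source) ,
  (λ A sink → sink⇒maximum ℤ._≤_ (M2 D) (M2-mono-arc D D-nonInc) sink
            , sink⇒maximum ℚ._≤_ (Z2sq D) (Z2sq-mono-arc D D-nonInc) sink)
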